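{- Let $\vdash$ be a regular entailment relation for an ordered group $G$, let $A,B\in\mathrm{P}_{\mathrm{fe}}^*(G)$ and $x\in G$. (1) If $A,A+x\vdash B$ and $A,A-x\vdash B$, then $A\vdash B$. (2) $A,A+x\vdash B$ holds if and only if $A\vdash B,B-x$.
   Context: Groups are commutative; an ordered group is a commutative group with a partial order $\le_G$ compatible with addition. $\mathrm{P}_{\mathrm{fe}}^*(G)$ is the set of nonempty finite subsets of $G$; $a$ stands for $\{a\}$, $A,A'$ for $A\cup A'$, $y+A=\{y+a\}$, $A-x=\{a-x\}$. An unbounded entailment relation on $G$ is a relation $\vdash$ on $\mathrm{P}_{\mathrm{fe}}^*(G)$ with $a\vdash a$; $A\vdash B\Rightarrow A,A'\vdash B,B'$; ($A\vdash B,c$ and $A,c\vdash B$) $\Rightarrow A\vdash B$. It is regular if moreover $a\le_G b\Rightarrow a\vdash b$; $A\vdash B\Rightarrow y+A\vdash y+B$ for all $y\in G$; and $y+a,z+b\vdash z+a,y+b$ for all $a,b,y,z\in G$. -}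

module Defs where

open import Level using (Level; _⊔_; suc)
open import Algebra.Bundles using (AbelianGroup)
open import Relation.Binary.Structures using (IsPartialOrder)
open import Relation.Binary.Core using (Rel)
open import Data.List.NonEmpty using (List⁺; [_]; _⁺++⁺_; toList) renaming (map to map⁺)
open import Data.List.Relation.Unary.Any using (Any)
open import Data.Product using (_×_)

record OrderedGroup (c ℓ₁ ℓ₂ : Level) : Set (Level.suc (c ⊔ ℓ₁ ⊔ ℓ₂)) where
  field
    abelianGroup : AbelianGroup c ℓ₁
  open AbelianGroup abelianGroup public
  field
    _≤_            : Rel Carrier ℓ₂
    isPartialOrder : IsPartialOrder _≈_ _≤_
    ≤-compat       : ∀ {a b} c → a ≤ b → (a ∙ c) ≤ (b ∙ c)

module FinSets {c ℓ₁ ℓ₂ : Level} (G : OrderedGroup c ℓ₁ ℓ₂) where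
  open OrderedGroup G

  -- Nonempty finite subsets of G, represented by nonempty lists,
  -- considered up to extensional equality (membership up to ≈).
  Pfe : Set c
  Pfe = List⁺ Carrier

  _∈ₛ_ : Carrier → Pfe → Set (c ⊔ ℓ₁)
  x ∈ₛ A = Any (x ≈_) (toList A)

  _≋_ : Pfe → Pfe → Set (c ⊔ ℓ₁)
  A ≋ B = (∀ x → x ∈ₛ A → x ∈ₛ B) × (∀ x → x ∈ₛ B → x ∈ₛ A)

  _,,_ : Pfe → Pfe → Pfe
  A ,, B = A ⁺++⁺ B

  _+ₛ_ : Carrier → Pfe → Pfe
  y +ₛ A = map⁺ (y ∙_) A

  _-ₛ_ : Pfe → Carrier → Pfe
  A -ₛ x = map⁺ (λ a → a ∙ (x ⁻¹)) A

  -- A + x  (= x + A, written on the right as in the paper)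
  _ₛ+_ : Pfe → Carrier → Pfe
  A ₛ+ x = map⁺ (λ a → a ∙ x) A

  -- An unbounded entailment relation on G (a relation on P_fe^*(G),
  -- hence invariant under equality of the represented finite sets).
  record IsEntailment {ℓ : Level} (_⊢_ : Pfe → Pfe → Set ℓ) : Set (c ⊔ ℓ₁ ⊔ ℓ) where
    field
      ⊢-resp : ∀ {A A' B B'} → A ≋ A' → B ≋ B' → A ⊢ B → A' ⊢ B'
      ⊢-refl : ∀ a → [ a ] ⊢ [ a ]
      ⊢-mono : ∀ {A A' B B'} → A ⊢ B → (A ,, A') ⊢ (B ,, B')
      ⊢-cut  : ∀ {A B} c → A ⊢ (B ,, [ c ]) → (A ,, [ c ]) ⊢ B → A ⊢ B

  record IsRegularEntailment {ℓ : Level} (_⊢_ : Pfe → Pfe → Set ℓ) : Set (c ⊔ ℓ₁ ⊔ ℓ₂ ⊔ ℓ) where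
    field
      isEntailment : IsEntailment _⊢_
      ⊢-order  : ∀ {a b} → a ≤ b → [ a ] ⊢ [ b ]
      ⊢-transl : ∀ {A B} y → A ⊢ B → (y +ₛ A) ⊢ (y +ₛ B)
      ⊢-swap   : ∀ a b y z → ([ y ∙ a ] ,, [ z ∙ b ]) ⊢ ([ z ∙ a ] ,, [ y ∙ b ])
    open IsEntailment isEntailment public

-- A regular entailment relation satisfies a, a' ⊢ a + x, a' - x (the swap axiom
-- with y = 0, z = x).  Cutting, one after the other, every element of A + x and
-- of A - x from the two hypotheses of (1) therefore leaves A ⊢ B.  For (2),
-- translating A, A + x ⊢ B by -x gives A - x, A ⊢ B - x, so (1) applies with
-- B, B - x on the right.  The converse is the mirror image: translate by x and
-- cut on the right, using the same sequent for the pairs b - x, b' + x.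
module Submission where

open import Defs
open import Level using (Level)
open import Data.Product using (_×_; _,_)
open import Data.Sum using (inj₁; inj₂)
open import Data.List using ([]; _∷_; _++_)
open import Data.List.Properties using (map-++; ++-assoc)
open import Data.List.NonEmpty using ([_]; toList)
open import Data.List.Relation.Unary.Any using (here; there)
open import Function.Base using (flip)
open import Function.Bundles using (_⇔_; mk⇔)
import Data.List.Membership.Setoid as Membership
import Data.List.Membership.Setoid.Properties as Membershipₚ
import Data.List.Relation.Binary.Subset.Setoid as Subset
import Data.List.Relation.Binary.Subset.Setoid.Properties as Subsetₚ
import Data.List.Relation.Binary.Equality.Setoid as ListEquality
import Relation.Binary.Reasoning.Setoid as SetoidReasoning
import Relation.Binary.PropositionalEquality as ≡

module Properties {c ℓ₁ ℓ₂ : Level} (G : OrderedGroup c ℓ₁ ℓ₂) where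
  open OrderedGroup G
  open FinSets G
  open Membership setoid using (_∈_)
  open Membershipₚ using (∈-resp-≈; ∈-++⁺ˡ; ∈-++⁺ʳ; ∈-++⁻; ∈-map⁺; ∈-map⁻)
  open Subset setoid using (_⊆_)
  open Subsetₚ using (⊆-refl; ⊆-trans; ⊆-reflexive; xs⊆xs++ys; xs⊆ys++xs; ++⁺; ∈-∷⁺ʳ)
  open ListEquality setoid using (≋-reflexive)

  infix 4 _⊆ₛ_

  _⊆ₛ_ : Pfe → Pfe → Set _
  A ⊆ₛ B = toList A ⊆ toList B

  ++-⊆ : ∀ {xs ys zs} → xs ⊆ zs → ys ⊆ zs → xs ++ ys ⊆ zs
  ++-⊆ {xs} p q m with ∈-++⁻ setoid xs m
  ... | inj₁ m′ = p m′
  ... | inj₂ m′ = q m′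

  ,,-comm-⊆ : ∀ A B → (A ,, B) ⊆ₛ (B ,, A)
  ,,-comm-⊆ A B = ++-⊆ (xs⊆ys++xs setoid _ (toList B)) (xs⊆xs++ys setoid _ (toList A))

  pair-⊆ : ∀ {a b X} → a ∈ₛ X → b ∈ₛ X → ([ a ] ,, [ b ]) ⊆ₛ X
  pair-⊆ a∈X b∈X = ∈-∷⁺ʳ setoid a∈X (∈-∷⁺ʳ setoid b∈X λ ())

  ∈-last : ∀ {a b} X → a ≈ b → a ∈ₛ (X ,, [ b ])
  ∈-last X a≈b = ∈-++⁺ʳ setoid (toList X) (here a≈b)

  ∈-penultimate : ∀ {a b} X d → a ≈ b → a ∈ₛ ((X ,, [ b ]) ,, [ d ])
  ∈-penultimate X d a≈b = ∈-++⁺ˡ setoid (∈-last X a≈b)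

  +ₛ-⊆-ₛ+ : ∀ A y → (y +ₛ A) ⊆ₛ (A ₛ+ y)
  +ₛ-⊆-ₛ+ A y m with ∈-map⁻ setoid setoid m
  ... | a , a∈A , z≈y∙a = ∈-resp-≈ setoid (sym (trans z≈y∙a (comm y a)))
                            (∈-map⁺ setoid setoid ∙-congʳ a∈A)

  ₛ+-,,-⊆ : ∀ A B y → ((A ,, B) ₛ+ y) ⊆ₛ ((A ₛ+ y) ,, (B ₛ+ y))
  ₛ+-,,-⊆ A B y = ⊆-reflexive setoid (≋-reflexive (map-++ (_∙ y) (toList A) (toList B)))

  ∙-cancel : ∀ a {y z} → y ∙ z ≈ ε → (a ∙ y) ∙ z ≈ a
  ∙-cancel a {y} {z} y∙z≈ε = begin
    (a ∙ y) ∙ z ≈⟨ assoc a y z ⟩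
    a ∙ (y ∙ z) ≈⟨ ∙-congˡ y∙z≈ε ⟩
    a ∙ ε       ≈⟨ identityʳ a ⟩
    a           ∎
    where open SetoidReasoning setoid

  ₛ+-ₛ+-⊆ : ∀ A {y z} → y ∙ z ≈ ε → ((A ₛ+ y) ₛ+ z) ⊆ₛ A
  ₛ+-ₛ+-⊆ A {y} {z} y∙z≈ε m with ∈-map⁻ setoid setoid m
  ... | w , w∈A+y , u≈w∙z with ∈-map⁻ setoid setoid w∈A+y
  ... | a , a∈A , w≈a∙y =
    ∈-resp-≈ setoid (sym (trans u≈w∙z (trans (∙-congʳ w≈a∙y) (∙-cancel a y∙z≈ε)))) a∈A

  ,,-ₛ+-ₛ+-⊆ : ∀ A {y z} → y ∙ z ≈ ε → ((A ,, (A ₛ+ y)) ₛ+ z) ⊆ₛ (A ,, (A ₛ+ z))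
  ,,-ₛ+-ₛ+-⊆ A {y} {z} y∙z≈ε = ⊆-trans setoid (ₛ+-,,-⊆ A (A ₛ+ y) z)
    (⊆-trans setoid (++⁺ setoid (⊆-refl setoid {toList (A ₛ+ z)}) (ₛ+-ₛ+-⊆ A y∙z≈ε))
                    (,,-comm-⊆ (A ₛ+ z) A))

  opposite : ∀ {ℓ} {_⊢_ : Pfe → Pfe → Set ℓ} → IsEntailment _⊢_ → IsEntailment (flip _⊢_)
  opposite ent = record
    { ⊢-resp = λ A≋A′ B≋B′ → ⊢-resp B≋B′ A≋A′
    ; ⊢-refl = ⊢-refl
    ; ⊢-mono = ⊢-mono
    ; ⊢-cut  = λ c left right → ⊢-cut c right left
    }
    where open IsEntailment ent

  module Entailment {ℓ} {_⊢_ : Pfe → Pfe → Set ℓ} (ent : IsEntailment _⊢_) where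
    open IsEntailment ent

    weaken : ∀ {A A′ B B′} → A ⊆ₛ A′ → B ⊆ₛ B′ → A ⊢ B → A′ ⊢ B′
    weaken {A} {A′} {B} {B′} A⊆A′ B⊆B′ A⊢B =
      ⊢-resp (absorb A⊆A′) (absorb B⊆B′) (⊢-mono {A' = A′} {B' = B′} A⊢B)
      where
      absorb : ∀ {X Y} → X ⊆ₛ Y → (X ,, Y) ≋ Y
      absorb {X} X⊆Y = (λ _ → ++-⊆ X⊆Y (⊆-refl setoid)) , (λ _ → xs⊆ys++xs setoid _ (toList X))

    cut-all : ∀ cs {Γ Γ′ Δ} → toList Γ′ ⊆ toList Γ ++ cs → Γ′ ⊢ Δ →
              (∀ {c} → c ∈ cs → Γ ⊢ (Δ ,, [ c ])) → Γ ⊢ Δ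
    cut-all []       {Γ} Γ′⊆Γ Γ′⊢Δ _   =
      weaken (⊆-trans setoid Γ′⊆Γ (++-⊆ (⊆-refl setoid) λ ())) (⊆-refl setoid) Γ′⊢Δ
    cut-all (c ∷ cs) {Γ} Γ′⊆Γ Γ′⊢Δ cut =
      ⊢-cut c (cut (here refl))
        (cut-all cs (⊆-trans setoid Γ′⊆Γ reassociate) Γ′⊢Δ
          λ c′∈cs → weaken (xs⊆xs++ys setoid _ _) (⊆-refl setoid) (cut (there c′∈cs)))
      where
      reassociate : toList Γ ++ c ∷ cs ⊆ toList (Γ ,, [ c ]) ++ cs
      reassociate = ⊆-reflexive setoid (≋-reflexive (≡.sym (++-assoc (toList Γ) (c ∷ []) cs)))

    cut-pairs : ∀ {Γ Δ} C D → (Γ ,, C) ⊢ Δ → (Γ ,, D) ⊢ Δ →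
                (∀ {c d} → c ∈ₛ C → d ∈ₛ D → Γ ⊢ ((Δ ,, [ c ]) ,, [ d ])) →
                Γ ⊢ Δ
    cut-pairs C D Γ∪C⊢Δ Γ∪D⊢Δ cut =
      cut-all (toList C) (⊆-refl setoid) Γ∪C⊢Δ λ c∈C →
        cut-all (toList D) (⊆-refl setoid)
          (weaken (⊆-refl setoid) (xs⊆xs++ys setoid _ _) Γ∪D⊢Δ) (cut c∈C)

  cut-pairsʳ : ∀ {ℓ} {_⊢_ : Pfe → Pfe → Set ℓ} → IsEntailment _⊢_ →
               ∀ {Γ Δ} C D → Γ ⊢ (Δ ,, C) → Γ ⊢ (Δ ,, D) →
               (∀ {c d} → c ∈ₛ C → d ∈ₛ D → ((Γ ,, [ c ]) ,, [ d ]) ⊢ Δ) →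
               Γ ⊢ Δ
  cut-pairsʳ ent = Entailment.cut-pairs (opposite ent)

  module Regular {ℓ} {_⊢_ : Pfe → Pfe → Set ℓ} (reg : IsRegularEntailment _⊢_) where
    open IsRegularEntailment reg
    open Entailment isEntailment

    ⊢-shift : ∀ {A B} y → A ⊢ B → (A ₛ+ y) ⊢ (B ₛ+ y)
    ⊢-shift {A} {B} y A⊢B = weaken (+ₛ-⊆-ₛ+ A y) (+ₛ-⊆-ₛ+ B y) (⊢-transl y A⊢B)

    separate : ∀ a b x → ([ a ] ,, [ b ]) ⊢ ([ a ∙ x ] ,, [ b ∙ x ⁻¹ ])
    separate a b x =
      weaken (pair-⊆ (here (identityˡ a)) (there (here x∙[b∙x⁻¹]≈b)))
             (pair-⊆ (here (comm x a)) (there (here (identityˡ (b ∙ x ⁻¹)))))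
             (⊢-swap a (b ∙ x ⁻¹) ε x)
      where
      x∙[b∙x⁻¹]≈b : x ∙ (b ∙ x ⁻¹) ≈ b
      x∙[b∙x⁻¹]≈b = trans (comm x (b ∙ x ⁻¹)) (∙-cancel b (inverseˡ x))

    eliminate-± : ∀ A Δ x → (A ,, (A ₛ+ x)) ⊢ Δ → (A ,, (A -ₛ x)) ⊢ Δ → A ⊢ Δ
    eliminate-± A Δ x A∪A+x⊢Δ A∪A-x⊢Δ = cut-pairs (A ₛ+ x) (A -ₛ x) A∪A+x⊢Δ A∪A-x⊢Δ separated
      where
      separated : ∀ {c d} → c ∈ₛ (A ₛ+ x) → d ∈ₛ (A -ₛ x) →
                  A ⊢ ((Δ ,, [ c ]) ,, [ d ])
      separated c∈A+x d∈A-x with ∈-map⁻ setoid setoid c∈A+x | ∈-map⁻ setoid setoid d∈A-x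
      ... | a , a∈A , c≈a∙x | b , b∈A , d≈b∙x⁻¹ =
        weaken (pair-⊆ a∈A b∈A)
               (pair-⊆ (∈-penultimate Δ _ (sym c≈a∙x)) (∈-last (Δ ,, [ _ ]) (sym d≈b∙x⁻¹)))
               (separate a b x)

    -- A -ₛ x is A ₛ+ x ⁻¹ by definition, which is what ,,-ₛ+-ₛ+-⊆ produces here.
    +ˡ⇒-ʳ : ∀ A B x → (A ,, (A ₛ+ x)) ⊢ B → A ⊢ (B ,, (B -ₛ x))
    +ˡ⇒-ʳ A B x A∪A+x⊢B = eliminate-± A (B ,, (B -ₛ x)) x
      (weaken (⊆-refl setoid) (xs⊆xs++ys setoid _ _) A∪A+x⊢B)
      (weaken (,,-ₛ+-ₛ+-⊆ A (inverseʳ x)) (xs⊆ys++xs setoid _ (toList B)) (⊢-shift (x ⁻¹) A∪A+x⊢B))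

    -ʳ⇒+ˡ : ∀ A B x → A ⊢ (B ,, (B -ₛ x)) → (A ,, (A ₛ+ x)) ⊢ B
    -ʳ⇒+ˡ A B x A⊢B∪B-x = cut-pairsʳ isEntailment (B -ₛ x) (B ₛ+ x)
      (weaken (xs⊆xs++ys setoid _ _) (⊆-refl setoid) A⊢B∪B-x)
      (weaken (xs⊆ys++xs setoid _ (toList A)) (,,-ₛ+-ₛ+-⊆ B (inverseˡ x)) (⊢-shift x A⊢B∪B-x))
      separated
      where
      separated : ∀ {c d} → c ∈ₛ (B -ₛ x) → d ∈ₛ (B ₛ+ x) →
                  (((A ,, (A ₛ+ x)) ,, [ c ]) ,, [ d ]) ⊢ B
      separated c∈B-x d∈B+x with ∈-map⁻ setoid setoid c∈B-x | ∈-map⁻ setoid setoid d∈B+x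
      ... | a , a∈B , c≈a∙x⁻¹ | b , b∈B , d≈b∙x =
        weaken (pair-⊆ (∈-penultimate (A ,, (A ₛ+ x)) _ (sym c≈a∙x⁻¹))
                       (∈-last ((A ,, (A ₛ+ x)) ,, [ _ ]) (sym d≈b∙x)))
               (pair-⊆ (∈-resp-≈ setoid (sym (∙-cancel a (inverseˡ x))) a∈B)
                       (∈-resp-≈ setoid (sym (∙-cancel b (inverseʳ x))) b∈B))
               (separate (a ∙ x ⁻¹) (b ∙ x) x)

lemma2p7 : ∀ {c ℓ₁ ℓ₂ ℓ : Level} (G : OrderedGroup c ℓ₁ ℓ₂)
    → let open FinSets G in
    (_⊢_ : Pfe → Pfe → Set ℓ) → IsRegularEntailment _⊢_
    → (A B : Pfe) (x : OrderedGroup.Carrier G)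
    → (((A ,, (A ₛ+ x)) ⊢ B) → ((A ,, (A -ₛ x)) ⊢ B) → A ⊢ B)
    × (((A ,, (A ₛ+ x)) ⊢ B) ⇔ (A ⊢ (B ,, (B -ₛ x))))
lemma2p7 G _⊢_ reg A B x = eliminate-± A B x , mk⇔ (+ˡ⇒-ʳ A B x) (-ʳ⇒+ˡ A B x)
  where open Properties.Regular G reg
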